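{- Let $U\le G$. Then (i) every $U$-symmetric social preference correspondence is $U$-consistent; (ii) if $U\le S_h\times S_n\times\{id\}$, then a social preference correspondence is $U$-symmetric if and only if it is $U$-consistent.
   Context: Let $n,h\ge 2$ be integers, $N=\{1,\dots,n\}$. $S_m$ is the symmetric group on $\{1,\dots,m\}$ with product $(\sigma\tau)(x)=\sigma(\tau(x))$. $\mathbf L(N)$ is the set of linear orders on $N$; a linear order $q$ with $q(1)\succ\dots\succ q(n)$ is identified with the permutation $r\mapsto q(r)$ in $S_n$. Let $\rho_0(r)=n-r+1$, $\Omega=\{id,\rho_0\}\le S_n$. $\mathcal P=\mathbf L(N)^h$. $G=S_h\times S_n\times\Omega$; $p^{(\varphi,\psi,\rho)}$ is the profile with $i$-th component $\psi p_{\varphi^{ -1}(i)}\rho$. A social preference correspondence assigns to each $p$ a subset $C(p)\subseteq\mathbf L(N)$; for $\psi\in S_n,\rho\in\Omega$, $\psi C(p)\rho=\{\psi q\rho:q\in C(p)\}$. $C$ is $U$-symmetric if $C(p^{(\varphi,\psi,\rho)})=\psi C(p)\rho$ for all $p$ and $(\varphi,\psi,\rho)\in U$; $C$ is $U$-consistent if for all $p$ and $(\varphi,\psi,\rho)\in U$: $C(p^{(\varphi,\psi,\rho)})=\psi C(p)$ if $\rho=id$, and $C(p^{(\varphi,\psi,\rho)})\ne\psi C(p)$ if $\rho=\rho_0$ and $|C(p)|=1$. -}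

module Defs where

open import Data.Nat using (ℕ)
open import Data.Fin using (Fin; opposite)
open import Data.Fin.Permutation using (Permutation′; _⟨$⟩ʳ_; _⟨$⟩ˡ_)
open import Data.Vec using (Vec; lookup; tabulate)
open import Data.Product using (Σ; ∃; _×_; _,_)
open import Relation.Binary.PropositionalEquality using (_≡_)
open import Relation.Nullary using (¬_)

Perm : ℕ → Set
Perm m = Permutation′ m

data Ω : Set where
  idΩ ρ₀ : Ω

-- action of an element of Ω on positions: ρ₀(r) = n - r + 1
Ωfun : ∀ {n} → Ω → Fin n → Fin n
Ωfun idΩ r = r
Ωfun ρ₀  r = opposite r

_·Ω_ : Ω → Ω → Ω
idΩ ·Ω b = b
ρ₀  ·Ω idΩ = ρ₀
ρ₀  ·Ω ρ₀ = idΩ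

-- A candidate linear order q is stored as the vector (q(1),…,q(n)),
-- i.e. the map r ↦ q(r) (q(1) ≻ … ≻ q(n)).
Ranking : ℕ → Set
Ranking n = Vec (Fin n) n

-- it is a linear order iff r ↦ q(r) is a permutation of N (injective suffices on Fin n)
IsLinOrd : ∀ {n} → Ranking n → Set
IsLinOrd {n} q = ∀ (r s : Fin n) → lookup q r ≡ lookup q s → r ≡ s

act : ∀ {n} → Perm n → Ranking n → Ω → Ranking n
act ψ q ρ = tabulate (λ r → ψ ⟨$⟩ʳ lookup q (Ωfun ρ r))

Profile : ℕ → ℕ → Set
Profile n h = Vec (Ranking n) h

record GElt (n h : ℕ) : Set where
  constructor ⟨_,_,_⟩
  field
    φ : Perm h
    ψ : Perm n
    ρ : Ω
open GElt public

_^_ : ∀ {n h} → Profile n h → GElt n h → Profile n h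
p ^ g = tabulate (λ i → act (ψ g) (lookup p (φ g ⟨$⟩ˡ i)) (ρ g))

-- U ≤ G : a subgroup, given as a predicate on (representatives of) G-elements,
-- characterised pointwise so that it does not depend on representatives.
record IsSubgroup {n h : ℕ} (U : GElt n h → Set) : Set where
  field
    respects : ∀ g k → (∀ i → φ g ⟨$⟩ʳ i ≡ φ k ⟨$⟩ʳ i) → (∀ r → ψ g ⟨$⟩ʳ r ≡ ψ k ⟨$⟩ʳ r)
               → ρ g ≡ ρ k → U g → U k
    has-id : ∀ k → (∀ i → φ k ⟨$⟩ʳ i ≡ i) → (∀ r → ψ k ⟨$⟩ʳ r ≡ r) → ρ k ≡ idΩ → U k
    closed-mul : ∀ g g′ k → U g → U g′
               → (∀ i → φ k ⟨$⟩ʳ i ≡ φ g ⟨$⟩ʳ (φ g′ ⟨$⟩ʳ i))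
               → (∀ r → ψ k ⟨$⟩ʳ r ≡ ψ g ⟨$⟩ʳ (ψ g′ ⟨$⟩ʳ r))
               → ρ k ≡ (ρ g ·Ω ρ g′) → U k
    closed-inv : ∀ g k → U g
               → (∀ i → φ k ⟨$⟩ʳ i ≡ φ g ⟨$⟩ˡ i)
               → (∀ r → ψ k ⟨$⟩ʳ r ≡ ψ g ⟨$⟩ˡ r)
               → ρ k ≡ ρ g → U k

Subset : ℕ → Set₁
Subset n = Ranking n → Set

_≐_ : ∀ {n} → Subset n → Subset n → Set
A ≐ B = ∀ q → (A q → B q) × (B q → A q)

image : ∀ {n} → Perm n → Subset n → Ω → Subset n
image ψ A ρ v = ∃ λ q → A q × (v ≡ act ψ q ρ)

IsSingleton : ∀ {n} → Subset n → Set
IsSingleton A = ∃ λ q → ∀ v → (A v → v ≡ q) × (v ≡ q → A v)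

Correspondence : ℕ → ℕ → Set₁
Correspondence n h = Profile n h → Subset n

IsSPC : ∀ {n h} → Correspondence n h → Set
IsSPC C = ∀ p q → C p q → IsLinOrd q

USymmetric : ∀ {n h} → (GElt n h → Set) → Correspondence n h → Set
USymmetric U C = ∀ p g → U g → C (p ^ g) ≐ image (ψ g) (C p) (ρ g)

UConsistent : ∀ {n h} → (GElt n h → Set) → Correspondence n h → Set
UConsistent U C = ∀ p g → U g →
  (ρ g ≡ idΩ → C (p ^ g) ≐ image (ψ g) (C p) idΩ) ×
  (ρ g ≡ ρ₀ → IsSingleton (C p) → ¬ (C (p ^ g) ≐ image (ψ g) (C p) idΩ))

module Submission where

-- The only non-trivial point is the second clause of consistency in (i).
-- If C(p) = {q} and g ∈ U reverses orders (ρ = ρ₀), symmetry gives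
-- C(p^g) = {ψ q ρ₀}; consistency forbids C(p^g) = {ψ q}.  These differ
-- because reversing a linear order on n ≥ 2 alternatives changes its top
-- element, and ψ is injective.

open import Defs
open import Data.Nat using (ℕ; suc; _≤_; s≤s; z≤n)
open import Data.Fin using (Fin; zero; opposite)
open import Data.Fin.Permutation using (_⟨$⟩ʳ_; _⟨$⟩ˡ_; inverseˡ)
open import Data.Vec using (lookup)
open import Data.Vec.Properties using (lookup∘tabulate)
open import Data.Product using (_×_; _,_; proj₁; proj₂)
open import Relation.Binary.PropositionalEquality
  using (_≡_; _≢_; refl; sym; cong; subst; module ≡-Reasoning)
open import Relation.Nullary using (¬_)

perm-injective : ∀ {m} (ψ′ : Perm m) {x y : Fin m} → ψ′ ⟨$⟩ʳ x ≡ ψ′ ⟨$⟩ʳ y → x ≡ y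
perm-injective ψ′ {x} {y} e = begin
  x                          ≡⟨ sym (inverseˡ ψ′) ⟩
  ψ′ ⟨$⟩ˡ (ψ′ ⟨$⟩ʳ x)      ≡⟨ cong (ψ′ ⟨$⟩ˡ_) e ⟩
  ψ′ ⟨$⟩ˡ (ψ′ ⟨$⟩ʳ y)      ≡⟨ inverseˡ ψ′ ⟩
  y                          ∎
  where open ≡-Reasoning

-- With at least two alternatives, reversing a linear order q changes it,
-- even after relabelling by ψ: the top of ψ q ρ₀ is ψ(q(n)), that of ψ q
-- is ψ(q(1)), and 1 ≠ n.
reversal-changes-order : ∀ {m} (ψ′ : Perm (suc (suc m))) (q : Ranking (suc (suc m))) →
  IsLinOrd q → act ψ′ q ρ₀ ≢ act ψ′ q idΩ
reversal-changes-order ψ′ q lin e with lin (opposite zero) zero (perm-injective ψ′ tops-agree)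
  where
  tops-agree : ψ′ ⟨$⟩ʳ lookup q (opposite zero) ≡ ψ′ ⟨$⟩ʳ lookup q zero
  tops-agree = begin
    ψ′ ⟨$⟩ʳ lookup q (opposite zero)  ≡⟨ sym (lookup∘tabulate (λ r → ψ′ ⟨$⟩ʳ lookup q (opposite r)) zero) ⟩
    lookup (act ψ′ q ρ₀) zero        ≡⟨ cong (λ v → lookup v zero) e ⟩
    lookup (act ψ′ q idΩ) zero       ≡⟨ lookup∘tabulate (λ r → ψ′ ⟨$⟩ʳ lookup q r) zero ⟩
    ψ′ ⟨$⟩ʳ lookup q zero             ∎
    where open ≡-Reasoning
... | ()

reversed-image-⊈ : ∀ {m} (ψ′ : Perm (suc (suc m))) {A : Subset (suc (suc m))} →
  (∀ q → A q → IsLinOrd q) → IsSingleton A →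
  ¬ (∀ v → image ψ′ A ρ₀ v → image ψ′ A idΩ v)
reversed-image-⊈ ψ′ {A} linear (q , A≡⟨q⟩) ⊆ with ⊆ (act ψ′ q ρ₀) (q , q∈A , refl)
  where
  q∈A : A q
  q∈A = proj₂ (A≡⟨q⟩ q) refl
... | q′ , q′∈A , e with proj₁ (A≡⟨q⟩ q′) q′∈A
... | refl = reversal-changes-order ψ′ q (linear q q′∈A) e

symmetric⇒consistent : ∀ {m h} (U : GElt (suc (suc m)) h → Set)
  (C : Correspondence (suc (suc m)) h) → IsSPC C → USymmetric U C → UConsistent U C
symmetric⇒consistent U C spc symmetric p g g∈U = preserving , reversing
  where
  C[p^g]≐ : ∀ {r} → ρ g ≡ r → C (p ^ g) ≐ image (ψ g) (C p) r
  C[p^g]≐ eq = subst (λ r → C (p ^ g) ≐ image (ψ g) (C p) r) eq (symmetric p g g∈U)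

  preserving : ρ g ≡ idΩ → C (p ^ g) ≐ image (ψ g) (C p) idΩ
  preserving = C[p^g]≐

  reversing : ρ g ≡ ρ₀ → IsSingleton (C p) → ¬ (C (p ^ g) ≐ image (ψ g) (C p) idΩ)
  reversing eq singleton C[p^g]≐plain = reversed-image-⊈ (ψ g) (spc p) singleton
    (λ v v∈reversed → proj₁ (C[p^g]≐plain v) (proj₂ (C[p^g]≐ eq v) v∈reversed))

consistent⇒symmetric : ∀ {n h} (U : GElt n h → Set) (C : Correspondence n h) →
  (∀ g → U g → ρ g ≡ idΩ) → UConsistent U C → USymmetric U C
consistent⇒symmetric U C preserves consistent p g g∈U =
  subst (λ r → C (p ^ g) ≐ image (ψ g) (C p) r) (sym ρg≡id)
        (proj₁ (consistent p g g∈U) ρg≡id)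
  where
  ρg≡id : ρ g ≡ idΩ
  ρg≡id = preserves g g∈U

proposition1 : ∀ (n h : ℕ) → 2 ≤ n → 2 ≤ h → (U : GElt n h → Set) → IsSubgroup U →
    (∀ (C : Correspondence n h) → IsSPC C → USymmetric U C → UConsistent U C) ×
    ((∀ g → U g → ρ g ≡ idΩ) → ∀ (C : Correspondence n h) → IsSPC C →
      (USymmetric U C → UConsistent U C) × (UConsistent U C → USymmetric U C))
proposition1 (suc (suc m)) h (s≤s (s≤s z≤n)) _ U _ =
  symmetric⇒consistent U ,
  λ preserves C spc → symmetric⇒consistent U C spc , consistent⇒symmetric U C preserves
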